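{- Let $G$ be a connected graph and $(T,\mathcal V)$, $\mathcal V=(V_t:t\in T)$, a normal semi-partition tree of $G$. Then: (1) for incomparable $t,t'\in T$, the vertex set of $G(\lceil t\rceil\cap\lceil t'\rceil)$ separates $V_t$ from $V_{t'}$ in $G$; (2) for every connected subgraph $H$ of $G$ that meets $G(T)$, there is a unique $T$-minimal element $t$ among the nodes $s\in T$ with $V_s\cap V(H)\neq\emptyset$; (3) if $T'\subseteq T$ is down-closed, then every component of $G(T)-G(T')$ is spanned by the set $V(\lfloor t\rfloor)$ for some $t$ minimal in $T\setminus T'$, where $\lfloor t\rfloor=\{s\in T: s\ge t\}$; (4) if $T'\subseteq T$ is down-closed, then for every component $D$ of $G-G(T')$ that meets $G(T)$, the graph $D\cap G(T)$ is a component of $G(T)-G(T')$.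
   Context: An order tree is a partially ordered set $(T,\le)$ with a unique minimal element (the root) such that for every $t$ the set $\lceil t\rceil=\{t'\in T:t'\le t\}$ is well-ordered; write $\mathring{\lceil t\rceil}=\lceil t\rceil\setminus\{t\}$. A set $X\subseteq T$ is down-closed (a rooted subtree) if $X=\bigcup_{x\in X}\lceil x\rceil$. For an order tree $T$, a graph on vertex set $T$ is a $T$-graph if the endvertices of every edge are comparable in $T$ and for every $t\in T$ its set of neighbours below $t$ is cofinal in $\mathring{\lceil t\rceil}$. Given a graph $G$, an order tree $T$ and non-empty sets $V_t\subseteq V(G)$ ($t\in T$), the pair $(T,\mathcal V)$ with $\mathcal V=(V_t:t\in T)$ is a normal semi-partition tree of $G$ if (a) the $V_t$ are pairwise disjoint; (b) each $G[V_t]$ is connected; (c) the graph obtained from $G[\bigcup_t V_t]$ by contracting each $V_t$ to a single vertex $t$ (deleting loops and parallel edges) is a $T$-graph; (d) for every path $P$ in $G$ with both endvertices in $\bigcup_t V_t$ and no inner vertices or edges in $G[\bigcup_t V_t]$, with endvertices $u\in V_t$, $v\in V_{t'}$, the nodes $t,t'$ are comparable in $T$. For $S\subseteq T$ write $V(S)=\bigcup_{t\in S}V_t$ and $G(S)=G[V(S)]$. -}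

module Defs where

open import Level using (0ℓ)
open import Data.Empty using (⊥)
open import Data.Product using (Σ; ∃; ∃-syntax; _×_; _,_; proj₁; proj₂)
open import Data.Sum using (_⊎_)
open import Data.List using (List; []; _∷_)
open import Data.List.Relation.Unary.All using (All)
open import Data.List.Relation.Unary.Any using (Any)
open import Data.List.Relation.Unary.Unique.Propositional using (Unique)
open import Relation.Nullary using (¬_)
open import Relation.Binary.PropositionalEquality using (_≡_)
open import Relation.Binary.Structures using (IsPartialOrder)

Pred : Set → Set₁
Pred A = A → Set

_⊆_ : {A : Set} → Pred A → Pred A → Set
P ⊆ Q = ∀ x → P x → Q x

module OrderNotions {N : Set} (_≤_ : N → N → Set) where

  _<_ : N → N → Set
  s < t = (s ≤ t) × ¬ (s ≡ t)

  Comparable : N → N → Set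
  Comparable s t = (s ≤ t) ⊎ (t ≤ s)

  ⌈_⌉ : N → Pred N
  ⌈ t ⌉ s = s ≤ t

  ⌈_⌉∘ : N → Pred N
  ⌈ t ⌉∘ s = s < t

  ⌊_⌋ : N → Pred N
  ⌊ t ⌋ s = t ≤ s

  Minimal : Pred N → N → Set
  Minimal S t = S t × (∀ s → S s → s ≤ t → s ≡ t)

  Least : Pred N → N → Set
  Least S t = S t × (∀ s → S s → t ≤ s)

  WellOrdered : Pred N → Set₁
  WellOrdered X =
    (∀ s t → X s → X t → Comparable s t) ×
    (∀ (S : Pred N) → S ⊆ X → (∃[ s ] S s) → ∃[ t ] Least S t)

  DownClosed : Pred N → Set
  DownClosed X = ∀ y → (X y → ∃[ x ] (X x × y ≤ x)) × ((∃[ x ] (X x × y ≤ x)) → X y)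

  Cofinal : Pred N → Pred N → Set
  Cofinal A B = (A ⊆ B) × (∀ b → B b → ∃[ a ] (A a × b ≤ a))

record OrderTree : Set₁ where
  field
    Node        : Set
    _≤_         : Node → Node → Set
    isPartialOrder : IsPartialOrder _≡_ _≤_
    root        : Node
  open OrderNotions _≤_ public
  field
    root-minimal : Minimal (λ _ → Node) root
    root-unique  : ∀ t → Minimal (λ _ → Node) t → t ≡ root
    downWellOrdered : ∀ t → WellOrdered ⌈ t ⌉

IsTGraph : (T : OrderTree) → (OrderTree.Node T → OrderTree.Node T → Set) → Set
IsTGraph T E =
  (∀ s t → E s t → Comparable s t) ×
  (∀ t → Cofinal (λ s → (s < t) × E s t) ⌈ t ⌉∘)
  where open OrderTree T

record Graph : Set₁ where
  field
    Vertex : Set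
    Adj    : Vertex → Vertex → Set
    Adj-sym    : ∀ {u v} → Adj u v → Adj v u
    Adj-irrefl : ∀ {u} → Adj u u → ⊥

module GraphNotions (G : Graph) where
  open Graph G

  data Walk : Vertex → Vertex → Set where
    []  : ∀ {v} → Walk v v
    _∷_ : ∀ {u v w} → Adj u v → Walk v w → Walk u w

  verts : ∀ {u v} → Walk u v → List Vertex
  verts {u} []      = u ∷ []
  verts {u} (e ∷ w) = u ∷ verts w

  initVerts : ∀ {u v} → Walk u v → List Vertex
  initVerts []            = []
  initVerts {u} (e ∷ w)   = u ∷ initVerts w

  innerVerts : ∀ {u v} → Walk u v → List Vertex
  innerVerts []      = []
  innerVerts (e ∷ w) = initVerts w

  edges : ∀ {u v} → Walk u v → List (Vertex × Vertex)
  edges []              = []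
  edges {u} (_∷_ {v = v} e w) = (u , v) ∷ edges w

  record Path (u v : Vertex) : Set where
    constructor path
    field
      walk   : Walk u v
      unique : Unique (verts walk)

  ConnectedGraph : Set
  ConnectedGraph = Vertex × (∀ u v → Path u v)

  record Subgraph : Set₁ where
    field
      V  : Pred Vertex
      E  : Vertex → Vertex → Set
      E-sym  : ∀ {u v} → E u v → E v u
      E⊆Adj  : ∀ {u v} → E u v → Adj u v
      E-ends : ∀ {u v} → E u v → V u × V v

  V[_] : Subgraph → Pred Vertex
  V[ H ] = Subgraph.V H

  data HWalk (H : Subgraph) : Vertex → Vertex → Set where
    []  : ∀ {v} → Subgraph.V H v → HWalk H v v
    _∷_ : ∀ {u v w} → Subgraph.E H u v → HWalk H v w → HWalk H u w

  ConnectedSubgraph : Subgraph → Set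
  ConnectedSubgraph H =
    (∃[ x ] Subgraph.V H x) ×
    (∀ u v → Subgraph.V H u → Subgraph.V H v → HWalk H u v)

  ConnectedSet : Pred Vertex → Set
  ConnectedSet X =
    (∃[ x ] X x) ×
    (∀ u v → X u → X v → Σ (Walk u v) (λ w → All X (verts w)))

  -- C is (the vertex set of) a component of the induced subgraph G[X]
  IsComponentOf : Pred Vertex → Pred Vertex → Set₁
  IsComponentOf X C =
    (C ⊆ X) × ConnectedSet C ×
    (∀ (C' : Pred Vertex) → C' ⊆ X → ConnectedSet C' → C ⊆ C' → C' ⊆ C)

  Separates : Pred Vertex → Pred Vertex → Pred Vertex → Set
  Separates X A B =
    ∀ a b → A a → B b → (p : Path a b) → Any X (verts (Path.walk p))

module _ (G : Graph) (T : OrderTree) where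
  open Graph G
  open GraphNotions G
  open OrderTree T

  VOf : (Node → Pred Vertex) → Pred Node → Pred Vertex
  VOf V S x = ∃[ t ] (S t × V t x)

  -- the graph obtained by contracting each V_t (loops and parallel
  -- edges deleted): t ~ t' iff t ≠ t' and some edge joins V_t to V_t'
  ContractedAdj : (Node → Pred Vertex) → Node → Node → Set
  ContractedAdj V t t' =
    ¬ (t ≡ t') × ∃[ x ] ∃[ y ] (V t x × V t' y × Adj x y)

  record IsNormalSemiPartitionTree (V : Node → Pred Vertex) : Set₁ where
    U : Pred Vertex
    U = VOf V (λ _ → Node)
    field
      nonempty  : ∀ t → ∃[ x ] V t x
      disjoint  : ∀ t t' x → V t x → V t' x → t ≡ t'
      connected : ∀ t → ConnectedSet (V t)
      contraction-TGraph : IsTGraph T (ContractedAdj V)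
      paths-comparable :
        ∀ u v (p : Path u v) t t' → V t u → V t' v →
        All (λ x → ¬ U x) (innerVerts (Path.walk p)) →
        All (λ e → ¬ (U (proj₁ e) × U (proj₂ e)))
            (edges (Path.walk p)) →
        Comparable t t'

-- A path of G between two parts V s and V b moves through T in steps between
-- comparable nodes (Linked): an edge inside V(T) joins comparable nodes because
-- the contraction is a T-graph, and an excursion outside V(T) does so by the
-- path condition (d). Each claim propagates an order-theoretic invariant along
-- such a chain of steps: for (1), that ⌈s⌉ meets ⌈t⌉ ∖ ⌈t'⌉; for (3), that s ≥ t;
-- for (4), that V s is reachable inside D ∩ V(T). Components are recognised by
-- absorbing the connected sets V(⌊t⌋).
module Submission where

open import Defs
open import Level using (0ℓ)
open import Axiom.ExcludedMiddle using (ExcludedMiddle)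
open import Axiom.DoubleNegationElimination using (em⇒dne)
open import Data.Empty using (⊥-elim)
open import Data.Product using (Σ; ∃; ∃-syntax; _×_; _,_; proj₁; proj₂)
open import Data.Sum using (_⊎_; inj₁; inj₂)
open import Data.List using ([]; _∷_)
open import Data.List.Membership.Propositional using (_∈_)
open import Data.List.Relation.Unary.All as All using (All; []; _∷_; lookupAny)
open import Data.List.Relation.Unary.All.Properties using (¬Any⇒All¬)
open import Data.List.Relation.Unary.Any using (here; there)
open import Data.List.Relation.Unary.AllPairs using ([]; _∷_)
open import Data.List.Relation.Unary.Unique.Propositional using (Unique)
open import Function using (_∘_; id)
open import Relation.Nullary using (¬_; yes; no)
open import Relation.Binary.PropositionalEquality using (_≡_; refl; sym; cong; subst)
open import Relation.Binary.Structures using (IsPartialOrder)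
open import Relation.Binary.Construct.Closure.ReflexiveTransitive using (Star; ε; _◅_; fold)

Star-transport : ∀ {I : Set} {R : I → I → Set} (P : I → Set) →
                 (∀ {i j} → R i j → P i → P j) → ∀ {i j} → Star R i j → P i → P j
Star-transport P step = fold (λ i j → P i → P j) (λ r f → f ∘ step r) id

module Walks (G : Graph) where
  open Graph G
  open GraphNotions G

  Reach : Pred Vertex → Vertex → Vertex → Set
  Reach X u v = Σ (Walk u v) (λ w → All X (verts w))

  PathIn : Pred Vertex → Vertex → Vertex → Set
  PathIn X u v = Σ (Path u v) (λ p → All X (verts (Path.walk p)))

  infixr 5 _++ʷ_
  _++ʷ_ : ∀ {u v w} → Walk u v → Walk v w → Walk u w
  []      ++ʷ q = q
  (e ∷ p) ++ʷ q = e ∷ (p ++ʷ q)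

  ++ʷ-assoc : ∀ {a b c d} (p : Walk a b) (q : Walk b c) (r : Walk c d) →
              (p ++ʷ q) ++ʷ r ≡ p ++ʷ (q ++ʷ r)
  ++ʷ-assoc []      q r = refl
  ++ʷ-assoc (e ∷ p) q r = cong (e ∷_) (++ʷ-assoc p q r)

  reverse : ∀ {u v} → Walk u v → Walk v u
  reverse []      = []
  reverse (e ∷ w) = reverse w ++ʷ (Adj-sym e ∷ [])

  initVerts-snoc : ∀ {a b c} (p : Walk a b) (e : Adj b c) → initVerts (p ++ʷ (e ∷ [])) ≡ verts p
  initVerts-snoc []      e = refl
  initVerts-snoc (_ ∷ p) e = cong (_ ∷_) (initVerts-snoc p e)

  module _ {P : Pred Vertex} where

    All-head : ∀ {a b} (w : Walk a b) → All P (verts w) → P a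
    All-head []      (pa ∷ _) = pa
    All-head (_ ∷ _) (pa ∷ _) = pa

    All-last : ∀ {a b} (w : Walk a b) → All P (verts w) → P b
    All-last []      (pb ∷ _)  = pb
    All-last (_ ∷ w) (_ ∷ pw) = All-last w pw

    All-++ʷ⁺ : ∀ {a b c} (p : Walk a b) (q : Walk b c) →
               All P (verts p) → All P (verts q) → All P (verts (p ++ʷ q))
    All-++ʷ⁺ []      q _         pq = pq
    All-++ʷ⁺ (_ ∷ p) q (pa ∷ pp) pq = pa ∷ All-++ʷ⁺ p q pp pq

    All-++ʷ⁻ˡ : ∀ {a b c} (p : Walk a b) (q : Walk b c) → All P (verts (p ++ʷ q)) → All P (verts p)
    All-++ʷ⁻ˡ []      q pq         = All-head q pq ∷ []
    All-++ʷ⁻ˡ (_ ∷ p) q (pa ∷ ppq) = pa ∷ All-++ʷ⁻ˡ p q ppq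

    All-reverse : ∀ {a b} (w : Walk a b) → All P (verts w) → All P (verts (reverse w))
    All-reverse []      pw        = pw
    All-reverse (e ∷ w) (pa ∷ pw) =
      All-++ʷ⁺ (reverse w) (Adj-sym e ∷ []) (All-reverse w pw) (All-head w pw ∷ pa ∷ [])

    All-initVerts⇒sources : ∀ {a b} (w : Walk a b) →
                            All P (initVerts w) → All (P ∘ proj₁) (edges w)
    All-initVerts⇒sources []      _         = []
    All-initVerts⇒sources (_ ∷ w) (pa ∷ pw) = pa ∷ All-initVerts⇒sources w pw

  Unique-++ʷ⁻ : ∀ {a b c} (p : Walk a b) (q : Walk b c) →
                Unique (verts (p ++ʷ q)) → Unique (verts p) × Unique (verts q)
  Unique-++ʷ⁻ []      q u         = [] ∷ [] , u
  Unique-++ʷ⁻ (_ ∷ p) q (a∉ ∷ u) with Unique-++ʷ⁻ p q u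
  ... | up , uq = All-++ʷ⁻ˡ p q a∉ ∷ up , uq

  module _ {X : Pred Vertex} where

    Reach-∷ : ∀ {u v w} → X u → Adj u v → Reach X v w → Reach X u w
    Reach-∷ xu e (w , xs) = e ∷ w , xu ∷ xs

    Reach-trans : ∀ {u v w} → Reach X u v → Reach X v w → Reach X u w
    Reach-trans (p , xp) (q , xq) = p ++ʷ q , All-++ʷ⁺ p q xp xq

    Reach-sym : ∀ {u v} → Reach X u v → Reach X v u
    Reach-sym (w , xs) = reverse w , All-reverse w xs

    Reach-mono : ∀ {Y u v} → X ⊆ Y → Reach X u v → Reach Y u v
    Reach-mono X⊆Y (w , xs) = w , All.map (X⊆Y _) xs

    connected-from-hub : ∀ {c} → X c → (∀ v → X v → Reach X c v) → ConnectedSet X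
    connected-from-hub {c} xc reach =
      (c , xc) , λ u v xu xv → Reach-trans (Reach-sym (reach u xu)) (reach v xv)

  HWalk⇒Reach : ∀ (H : Subgraph) {a b} → HWalk H a b → Reach V[ H ] a b
  HWalk⇒Reach H ([] ha)  = [] , ha ∷ []
  HWalk⇒Reach H (e ∷ w) = Reach-∷ (proj₁ (Subgraph.E-ends H e)) (Subgraph.E⊆Adj H e) (HWalk⇒Reach H w)

  ∪-connected : ∀ {A B c} → ConnectedSet A → ConnectedSet B → A c → B c →
                ConnectedSet (λ z → A z ⊎ B z)
  ∪-connected {A} {B} {c} (_ , A-conn) (_ , B-conn) ac bc = connected-from-hub (inj₁ ac) reach
    where
    reach : ∀ v → A v ⊎ B v → Reach (λ z → A z ⊎ B z) c v
    reach v (inj₁ av) = Reach-mono (λ _ → inj₁) (A-conn c v ac av)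
    reach v (inj₂ bv) = Reach-mono (λ _ → inj₂) (B-conn c v bc bv)

  component-absorbs : ∀ {X C C' x} → IsComponentOf X C → ConnectedSet C' → C' ⊆ X →
                      C x → C' x → C' ⊆ C
  component-absorbs {X} {C} {C'} (C⊆X , C-conn , maximal) C'-conn C'⊆X cx c'x y c'y =
    maximal (λ z → C z ⊎ C' z) C∪C'⊆X (∪-connected C-conn C'-conn cx c'x) (λ _ → inj₁) y (inj₂ c'y)
    where
    C∪C'⊆X : (λ z → C z ⊎ C' z) ⊆ X
    C∪C'⊆X z (inj₁ cz)  = C⊆X z cz
    C∪C'⊆X z (inj₂ c'z) = C'⊆X z c'z

  module _ (em : ExcludedMiddle 0ℓ) where

    suffix-from : ∀ {X a b x} (w : Walk a b) → x ∈ verts w → All X (verts w) → Unique (verts w) →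
                  PathIn X x b
    suffix-from []      (here refl) xs u             = path [] u , xs
    suffix-from (e ∷ w) (here refl) xs u             = path (e ∷ w) u , xs
    suffix-from (_ ∷ w) (there i)   (_ ∷ xs) (_ ∷ u) = suffix-from w i xs u

    Reach⇒PathIn : ∀ {X u v} → Reach X u v → PathIn X u v
    Reach⇒PathIn ([] , xs) = path [] ([] ∷ []) , xs
    Reach⇒PathIn {u = u} (e ∷ w , xu ∷ xs) with Reach⇒PathIn (w , xs)
    ... | path w' u' , xs' with em {u ∈ verts w'}
    ...   | yes u∈w' = suffix-from w' u∈w' xs' u'
    ...   | no  u∉w' = path (e ∷ w') (¬Any⇒All¬ _ u∉w' ∷ u') , xu ∷ xs'

module TreeFacts (T : OrderTree) where
  open OrderTree T
  module ≤ = IsPartialOrder isPartialOrder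

  comparable-below : ∀ {r a b} → a ≤ r → b ≤ r → Comparable a b
  comparable-below {r} {a} {b} = proj₁ (downWellOrdered r) a b

  minimal-below : ∀ (S : Pred Node) {s} → S s → ∃[ t ] (t ≤ s × Minimal S t)
  minimal-below S {s} ss
    with proj₂ (downWellOrdered s) (λ r → r ≤ s × S r) (λ _ → proj₁) (s , ≤.refl , ss)
  ... | t , (t≤s , st) , least =
    t , t≤s , st , λ r sr r≤t → ≤.antisym r≤t (least r (≤.trans r≤t t≤s , sr))

  Minimal-≡ : ∀ {S t t'} → Minimal S t → Minimal S t' → Comparable t t' → t ≡ t'
  Minimal-≡ (st , _)   (_ , min') (inj₁ t≤t') = min' _ st t≤t'
  Minimal-≡ (_ , min)  (st' , _)  (inj₂ t'≤t) = sym (min _ st' t'≤t)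

  <-induction : ExcludedMiddle 0ℓ → (P : Pred Node) →
                (∀ r → (∀ a → a < r → P a) → P r) → ∀ r → P r
  <-induction em P step r = em⇒dne em λ ¬pr →
    let m , _ , ¬pm , min = minimal-below (¬_ ∘ P) ¬pr
    in ¬pm (step m λ a (a≤m , a≢m) → em⇒dne em λ ¬pa → a≢m (min a ¬pa a≤m))

module NormalSemiPartitionTreeFacts
  (em : ExcludedMiddle 0ℓ) (G : Graph) (T : OrderTree)
  (V : OrderTree.Node T → Pred (Graph.Vertex G)) (N : IsNormalSemiPartitionTree G T V) where
  open Graph G
  open GraphNotions G
  open Walks G
  open OrderTree T
  open TreeFacts T
  open IsNormalSemiPartitionTree N

  VO : Pred Node → Pred Vertex
  VO = VOf G T V

  VO⊆U : ∀ {S} → VO S ⊆ U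
  VO⊆U _ (r , _ , vr) = r , r , vr

  comparable-across-edge : ∀ {s s' x y} → V s x → V s' y → Adj x y → Comparable s s'
  comparable-across-edge {s} {s'} vx vy x~y with em {s ≡ s'}
  ... | yes refl  = inj₁ ≤.refl
  ... | no  s≢s' = proj₁ contraction-TGraph s s' (s≢s' , _ , _ , vx , vy , x~y)

  comparable-across-excursion :
    ∀ {s s' x y₁ y z} → V s x → V s' z →
    (e₁ : Adj x y₁) (p : Walk y₁ y) (e : Adj y z) → All (¬_ ∘ U) (verts p) →
    Unique (verts (e₁ ∷ (p ++ʷ (e ∷ [])))) → Comparable s s'
  comparable-across-excursion {s} {s'} {x} {z = z} vx vz e₁ p e p∌U unique =
    paths-comparable x z (path (e₁ ∷ (p ++ʷ (e ∷ []))) unique) s s' vx vz inner outer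
    where
    inner : All (¬_ ∘ U) (initVerts (p ++ʷ (e ∷ [])))
    inner = subst (All (¬_ ∘ U)) (sym (initVerts-snoc p e)) p∌U
    outer : All (λ e → ¬ (U (proj₁ e) × U (proj₂ e))) (edges (e₁ ∷ (p ++ʷ (e ∷ []))))
    outer = (λ (_ , uy₁) → All-head p p∌U uy₁)
          ∷ All.map (λ ¬u (u , _) → ¬u u) (All-initVerts⇒sources (p ++ʷ (e ∷ [])) inner)

  Linked : Pred Vertex → Node → Node → Set
  Linked Q s s' = Comparable s s' × ∃[ x ] ∃[ y ] (V s x × V s' y × Q x × Q y)

  module _ {Q : Pred Vertex} where

    linked-along : ∀ {s b x v} → V s x → V b v → (w : Walk x v) →
                   Unique (verts w) → All Q (verts w) → Star (Linked Q) s b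
    -- x is the last vertex of V(T) visited, and e₁ ∷ p the excursion outside V(T) since then.
    linked-after-excursion :
      ∀ {s b x y₁ y v} → V s x → V b v → Q x → (e₁ : Adj x y₁) (p : Walk y₁ y) →
      All (¬_ ∘ U) (verts p) → (w : Walk y v) →
      Unique (verts (e₁ ∷ (p ++ʷ w))) → All Q (verts w) → Star (Linked Q) s b

    linked-along {s} {b} {x} vx vb [] _ _ with disjoint s b x vx vb
    ... | refl = ε
    linked-along vx vb (_∷_ {v = y} e w) u@(_ ∷ uw) (qx ∷ qw) with em {U y}
    ... | yes (_ , _ , vy) =
      (comparable-across-edge vx vy e , _ , _ , vx , vy , qx , All-head w qw) ◅ linked-along vy vb w uw qw
    ... | no ¬uy = linked-after-excursion vx vb qx e [] (¬uy ∷ []) w u qw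

    linked-after-excursion {b = b} vx vb qx e₁ p p∌U [] _ _ = ⊥-elim (All-last p p∌U (b , b , vb))
    linked-after-excursion vx vb qx e₁ p p∌U (_∷_ {v = z} e w) u (_ ∷ qw) with em {U z}
    ... | yes (_ , _ , vz) =
      let u-excursion , uw = Unique-++ʷ⁻ (e₁ ∷ (p ++ʷ (e ∷ []))) w (subst (Unique ∘ verts) reassoc u)
      in (comparable-across-excursion vx vz e₁ p e p∌U u-excursion , _ , _ , vx , vz , qx , All-head w qw)
         ◅ linked-along vz vb w uw qw
      where
      reassoc : e₁ ∷ (p ++ʷ (e ∷ w)) ≡ (e₁ ∷ (p ++ʷ (e ∷ []))) ++ʷ w
      reassoc = cong (e₁ ∷_) (sym (++ʷ-assoc p (e ∷ []) w))
    ... | no ¬uz =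
      linked-after-excursion vx vb qx e₁ (p ++ʷ (e ∷ []))
        (All-++ʷ⁺ p (e ∷ []) p∌U (All-last p p∌U ∷ ¬uz ∷ [])) w
        (subst (λ r → Unique (verts (e₁ ∷ r))) (sym (++ʷ-assoc p (e ∷ []) w)) u) qw

    path-linked : ∀ {s b x v} → V s x → V b v → (p : Path x v) →
                  All Q (verts (Path.walk p)) → Star (Linked Q) s b
    path-linked vx vb (path w u) = linked-along vx vb w u

    reach-linked : ∀ {s b x v} → V s x → V b v → Reach Q x v → Star (Linked Q) s b
    reach-linked vx vb r = let p , qp = Reach⇒PathIn em r in path-linked vx vb p qp

  -- Induction up the tree: each node r > t is reached from a lower neighbour
  -- a ≥ t, by cofinality of the lower neighbours of r in the T-graph.
  ⌊⌋-connected : ∀ t → ConnectedSet (VO ⌊ t ⌋)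
  ⌊⌋-connected t = connected-from-hub (t , ≤.refl , vx₀) λ z (r , t≤r , vz) → reach r t≤r z vz
    where
    x₀ : Vertex
    x₀ = proj₁ (nonempty t)
    vx₀ : V t x₀
    vx₀ = proj₂ (nonempty t)
    Reachable : Pred Node
    Reachable r = t ≤ r → ∀ z → V r z → Reach (VO ⌊ t ⌋) x₀ z
    reach-step : ∀ r → (∀ a → a < r → Reachable a) → Reachable r
    reach-step r ih t≤r z vz with em {t ≡ r}
    ... | yes refl = Reach-mono (λ _ vy → t , ≤.refl , vy) (proj₂ (connected t) x₀ z vx₀ vz)
    ... | no t≢r with proj₂ (proj₂ contraction-TGraph r) t (t≤r , t≢r)
    ...   | a , (a<r , _ , x , y , vx , vy , x~y) , t≤a =
      Reach-trans (ih a a<r t≤a x vx)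
        (Reach-∷ (a , t≤a , vx) x~y (Reach-mono (λ _ vy → r , t≤r , vy) (proj₂ (connected r) y z vy vz)))
    reach : ∀ r → Reachable r
    reach = <-induction em Reachable reach-step

  ⌊⌋-avoids-downClosed : ∀ {T'} → DownClosed T' → ∀ {t} → ¬ T' t → VO ⌊ t ⌋ ⊆ (λ x → ¬ VO T' x)
  ⌊⌋-avoids-downClosed dc {t} t∉T' x (r , t≤r , vr) (r' , r'∈T' , vr') with disjoint r r' x vr vr'
  ... | refl = t∉T' (proj₂ (dc t) (r , r'∈T' , t≤r))

  common-down-separates : ∀ t t' → ¬ Comparable t t' →
                          Separates (VO (λ s → s ≤ t × s ≤ t')) (V t) (V t')
  common-down-separates t t' t∦t' a b va vb p = em⇒dne em λ miss →
    let r , _ , r≰t' , r≤t' = Star-transport Above[t∖t'] step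
                                (path-linked va vb p (¬Any⇒All¬ _ miss)) (t , ≤.refl , t∦t' ∘ inj₁ , ≤.refl)
    in r≰t' r≤t'
    where
    X : Pred Vertex
    X = VO (λ s → s ≤ t × s ≤ t')
    Above[t∖t'] : Pred Node
    Above[t∖t'] s = ∃[ r ] (r ≤ t × ¬ r ≤ t' × r ≤ s)
    step : ∀ {s s'} → Linked (λ x → ¬ X x) s s' → Above[t∖t'] s → Above[t∖t'] s'
    step (inj₁ s≤s' , _) (r , r≤t , r≰t' , r≤s) = r , r≤t , r≰t' , ≤.trans r≤s s≤s'
    step {s' = s'} (inj₂ s'≤s , _ , y , _ , vy , _ , y∉X) (r , r≤t , r≰t' , r≤s)
      with comparable-below r≤s s'≤s
    ... | inj₁ r≤s' = r , r≤t , r≰t' , r≤s'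
    ... | inj₂ s'≤r = s' , ≤.trans s'≤r r≤t , (λ s'≤t' → y∉X (s' , (≤.trans s'≤r r≤t , s'≤t') , vy)) , ≤.refl

  Hit : Subgraph → Pred Node
  Hit H s = ∃[ x ] (V s x × V[ H ] x)

  minimal-hits-comparable : ∀ H → ConnectedSubgraph H → ∀ {t t'} →
                            Minimal (Hit H) t → Minimal (Hit H) t' → Comparable t t'
  minimal-hits-comparable H (_ , H-conn) {t} {t'} ((x , vx , hx) , min) ((x' , vx' , hx') , _) =
    em⇒dne em λ t∦t' →
      let p , p⊆H = Reach⇒PathIn em (HWalk⇒Reach H (H-conn x x' hx hx'))
          hz , r , (r≤t , r≤t') , vz = lookupAny p⊆H (common-down-separates t t' t∦t' x x' vx vx' p)
      in t∦t' (inj₁ (subst (_≤ t') (min r (_ , vz , hz) r≤t) r≤t'))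

  unique-minimal-hit : ∀ H → ConnectedSubgraph H → (∃[ x ] (V[ H ] x × U x)) →
                       Σ Node (λ t → Minimal (Hit H) t × (∀ t' → Minimal (Hit H) t' → t' ≡ t))
  unique-minimal-hit H H-conn (x , hx , _ , _ , vx) =
    let t , _ , min-t = minimal-below (Hit H) (x , vx , hx)
    in t , min-t , λ t' min-t' → Minimal-≡ min-t' min-t (minimal-hits-comparable H H-conn min-t' min-t)

  component-spanned-by-⌊⌋ :
    ∀ {T' C x s t} → DownClosed T' → IsComponentOf (λ x → U x × ¬ VO T' x) C →
    C x → V s x → t ≤ s → Minimal (λ r → ¬ T' r) t →
    ∀ y → (C y → VO ⌊ t ⌋ y) × (VO ⌊ t ⌋ y → C y)
  component-spanned-by-⌊⌋ {T'} {C} {x} {s} {t} dc C-comp@(C⊆X , (_ , C-conn) , _) cx vx t≤s min-t y =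
    C⊆⌊t⌋ , ⌊t⌋⊆C y
    where
    step : ∀ {r r'} → Linked C r r' → t ≤ r → t ≤ r'
    step (inj₁ r≤r' , _) t≤r = ≤.trans t≤r r≤r'
    step {r' = r'} (inj₂ r'≤r , _ , z , _ , vz , _ , cz) t≤r with comparable-below t≤r r'≤r
    ... | inj₁ t≤r' = t≤r'
    ... | inj₂ r'≤t =
      ≤.reflexive (sym (proj₂ min-t r' (λ r'∈T' → proj₂ (C⊆X z cz) (r' , r'∈T' , vz)) r'≤t))
    C⊆⌊t⌋ : C y → VO ⌊ t ⌋ y
    C⊆⌊t⌋ cy =
      let b , _ , vy = proj₁ (C⊆X y cy)
      in b , Star-transport (t ≤_) step (reach-linked vx vy (C-conn x y cx cy)) t≤s , vy
    ⌊t⌋⊆C : VO ⌊ t ⌋ ⊆ C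
    ⌊t⌋⊆C = component-absorbs C-comp (⌊⌋-connected t)
              (λ z h → VO⊆U z h , ⌊⌋-avoids-downClosed dc (proj₁ min-t) z h) cx (s , t≤s , vx)

  component-is-up-closure :
    ∀ T' → DownClosed T' → ∀ C → IsComponentOf (λ x → U x × ¬ VO T' x) C →
    Σ Node (λ t → Minimal (λ s → ¬ T' s) t × (∀ x → (C x → VO ⌊ t ⌋ x) × (VO ⌊ t ⌋ x → C x)))
  component-is-up-closure T' dc C C-comp@(C⊆X , ((x , cx) , _) , _) =
    let (s , _ , vx) , x∉V[T'] = C⊆X x cx
        t , t≤s , min-t = minimal-below (λ r → ¬ T' r) (λ s∈T' → x∉V[T'] (s , s∈T' , vx))
    in t , min-t , component-spanned-by-⌊⌋ dc C-comp cx vx t≤s min-t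

  component-meets-tree :
    ∀ T' → DownClosed T' → ∀ D → IsComponentOf (λ x → ¬ VO T' x) D → (∃[ x ] (D x × U x)) →
    IsComponentOf (λ x → U x × ¬ VO T' x) (λ x → D x × U x)
  component-meets-tree T' dc D D-comp@(D⊆X , (_ , D-conn) , _) (x₀ , dx₀ , ux₀@(s₀ , _ , vx₀)) =
    DU⊆X , DU-conn , DU-maximal
    where
    DU : Pred Vertex
    DU x = D x × U x
    DU⊆X : DU ⊆ (λ x → U x × ¬ VO T' x)
    DU⊆X z (dz , uz) = uz , D⊆X z dz
    ⌊⌋⊆D : ∀ {m z} → V m z → D z → VO ⌊ m ⌋ ⊆ D
    ⌊⌋⊆D {m} vz dz = component-absorbs D-comp (⌊⌋-connected m)
                       (⌊⌋-avoids-downClosed dc (λ m∈T' → D⊆X _ dz (m , m∈T' , vz))) dz (m , ≤.refl , vz)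
    reach-in-⌊⌋ : ∀ {m z a b} → V m z → D z → VO ⌊ m ⌋ a → VO ⌊ m ⌋ b → Reach DU a b
    reach-in-⌊⌋ {m} vz dz ha hb =
      Reach-mono (λ y h → ⌊⌋⊆D vz dz y h , VO⊆U y h) (proj₂ (⌊⌋-connected m) _ _ ha hb)
    Reachable : Pred Node
    Reachable s = ∀ x → V s x → Reach DU x₀ x
    step : ∀ {s s'} → Linked D s s' → Reachable s → Reachable s'
    step (inj₁ s≤s' , x , _ , vx , _ , dx , _) reach x' vx' =
      Reach-trans (reach x vx) (reach-in-⌊⌋ vx dx (_ , ≤.refl , vx) (_ , s≤s' , vx'))
    step (inj₂ s'≤s , x , _ , vx , vy , _ , dy) reach x' vx' =
      Reach-trans (reach x vx) (reach-in-⌊⌋ vy dy (_ , s'≤s , vx) (_ , ≤.refl , vx'))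
    DU-conn : ConnectedSet DU
    DU-conn = connected-from-hub (dx₀ , ux₀) λ v (dv , _ , _ , vv) →
      Star-transport Reachable step (reach-linked vx₀ vv (D-conn x₀ v dx₀ dv))
        (λ x vx → reach-in-⌊⌋ vx₀ dx₀ (_ , ≤.refl , vx₀) (_ , ≤.refl , vx)) v vv
    DU-maximal : ∀ C' → C' ⊆ (λ x → U x × ¬ VO T' x) → ConnectedSet C' → DU ⊆ C' → C' ⊆ DU
    DU-maximal C' C'⊆X C'-conn DU⊆C' z c'z =
      component-absorbs D-comp C'-conn (λ y c'y → proj₂ (C'⊆X y c'y)) dx₀ (DU⊆C' x₀ (dx₀ , ux₀)) z c'z ,
      proj₁ (C'⊆X z c'z)

lemma4p1 : ExcludedMiddle 0ℓ →
    (G : Graph) → GraphNotions.ConnectedGraph G →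
    (T : OrderTree) → (V : OrderTree.Node T → Pred (Graph.Vertex G)) →
    IsNormalSemiPartitionTree G T V →
    (∀ t t' → ¬ OrderTree.Comparable T t t' →
      GraphNotions.Separates G
        (VOf G T V (λ s → OrderTree._≤_ T s t × OrderTree._≤_ T s t'))
        (V t) (V t'))
    ×
    (∀ (H : GraphNotions.Subgraph G) → GraphNotions.ConnectedSubgraph G H →
      (∃[ x ] (GraphNotions.V[_] G H x × VOf G T V (λ _ → OrderTree.Node T) x)) →
      Σ (OrderTree.Node T) (λ t →
        OrderTree.Minimal T (λ s → ∃[ x ] (V s x × GraphNotions.V[_] G H x)) t ×
        (∀ t' → OrderTree.Minimal T (λ s → ∃[ x ] (V s x × GraphNotions.V[_] G H x)) t' →
          t' ≡ t)))
    ×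
    (∀ (T' : Pred (OrderTree.Node T)) → OrderTree.DownClosed T T' →
      ∀ (C : Pred (Graph.Vertex G)) →
      GraphNotions.IsComponentOf G
        (λ x → VOf G T V (λ _ → OrderTree.Node T) x × ¬ VOf G T V T' x) C →
      Σ (OrderTree.Node T) (λ t →
        OrderTree.Minimal T (λ s → ¬ T' s) t ×
        (∀ x → (C x → VOf G T V (OrderTree.⌊_⌋ T t) x) ×
               (VOf G T V (OrderTree.⌊_⌋ T t) x → C x))))
    ×
    (∀ (T' : Pred (OrderTree.Node T)) → OrderTree.DownClosed T T' →
      ∀ (D : Pred (Graph.Vertex G)) →
      GraphNotions.IsComponentOf G (λ x → ¬ VOf G T V T' x) D →
      (∃[ x ] (D x × VOf G T V (λ _ → OrderTree.Node T) x)) →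
      GraphNotions.IsComponentOf G
        (λ x → VOf G T V (λ _ → OrderTree.Node T) x × ¬ VOf G T V T' x)
        (λ x → D x × VOf G T V (λ _ → OrderTree.Node T) x))
lemma4p1 em G _ T V N =
  common-down-separates , unique-minimal-hit , component-is-up-closure , component-meets-tree
  where open NormalSemiPartitionTreeFacts em G T V N
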